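{- Let ${\cal A},{\cal B}$ be nonempty families of nonempty subsets of $\mathbb N$ and ${\cal A}\odot{\cal B}=\{A\wedge B\mid A\in{\cal A},B\in{\cal B}\}$. Then $G_{{\cal A}\odot{\cal B}}$ is the join of $G_{\cal A}$ and $G_{\cal B}$ with respect to $\le_L$: $G_{\cal A}\le_L G_{{\cal A}\odot{\cal B}}$, $G_{\cal B}\le_L G_{{\cal A}\odot{\cal B}}$, and for every $f\in M^*$ with $G_{\cal A}\le_L f$ and $G_{\cal B}\le_L f$ we have $G_{{\cal A}\odot{\cal B}}\le_L f$.
   Context: Notation: $ex$ is the (possibly undefined) result of applying the $e$-th partial recursive function to $x$; $\langle\cdot,\cdot\rangle$ a recursive pairing. For $A,C\subseteq\mathbb N$: $A\wedge C=\{\langle a,c\rangle\mid a\in A,c\in C\}$, $A\to C=\{e\mid\forall a\in A\ (ea\text{ defined and in }C)\}$. For a nonempty family ${\cal A}$ of subsets of $\mathbb N$, $G_{\cal A}(p)=\bigcup_{A\in{\cal A}}(A\to p)$. For $f:\mathcal P(\mathbb N)\to\mathcal P(\mathbb N)$, $E(f)=\bigcap_{p,q}((p\to q)\to(f(p)\to f(q)))$; $M^*$ is the set of $f$ with $E(f)\ne\emptyset$ and $\bigcup_pf(p)\ne\emptyset$. For $f,g$: $f\le g$ means $\bigcap_p(f(p)\to g(p))\ne\emptyset$; $L(g)(p)=\bigcap_{q}\big(((p\to q)\wedge(g(q)\to q))\to q\big)$; $f\le_L g$ means $f\le L(g)$. -}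

module Defs where

open import Level using (Level; _⊔_) renaming (suc to lsuc; zero to lzero)
open import Data.Nat using (ℕ; zero; suc; _+_; _<_)
open import Data.Product using (Σ; _×_; _,_; proj₁; proj₂)
open import Relation.Binary.PropositionalEquality using (_≡_)

tri : ℕ → ℕ
tri zero    = zero
tri (suc k) = suc k + tri k

⟨_,_⟩ : ℕ → ℕ → ℕ
⟨ a , c ⟩ = tri (a + c) + c

-- inverse of the pairing (enumeration (0,0),(1,0),(0,1),(2,0),(1,1),(0,2),…)
unpair : ℕ → ℕ × ℕ
unpair zero = 0 , 0
unpair (suc n) with unpair n
... | zero  , c = suc c , 0
... | suc a , c = a , suc c

data Code : Set where
  zeroC succC idC fstC sndC : Code
  pairC  : Code → Code → Code
  compC  : Code → Code → Code
  precC  : Code → Code → Code   -- h⟨x,0⟩ = f x ; h⟨x,n+1⟩ = g ⟨x,⟨n,h⟨x,n⟩⟩⟩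
  muC    : Code → Code

mutual
  data Eval : Code → ℕ → ℕ → Set where
    ev-zero : ∀ {x} → Eval zeroC x 0
    ev-succ : ∀ {x} → Eval succC x (suc x)
    ev-id   : ∀ {x} → Eval idC x x
    ev-fst  : ∀ {x} → Eval fstC x (proj₁ (unpair x))
    ev-snd  : ∀ {x} → Eval sndC x (proj₂ (unpair x))
    ev-pair : ∀ {f g x a b} → Eval f x a → Eval g x b → Eval (pairC f g) x ⟨ a , b ⟩
    ev-comp : ∀ {f g x y z} → Eval g x y → Eval f y z → Eval (compC f g) x z
    ev-prec : ∀ {f g x y} →
              PrecEval f g (proj₁ (unpair x)) (proj₂ (unpair x)) y →
              Eval (precC f g) x y
    ev-mu   : ∀ {f x n} → Eval f ⟨ x , n ⟩ 0 →
              (∀ m → m < n → Σ ℕ λ k → Eval f ⟨ x , m ⟩ (suc k)) →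
              Eval (muC f) x n

  data PrecEval (f g : Code) (x : ℕ) : ℕ → ℕ → Set where
    pr-zero : ∀ {y} → Eval f x y → PrecEval f g x zero y
    pr-suc  : ∀ {n y z} → PrecEval f g x n y → Eval g ⟨ x , ⟨ n , y ⟩ ⟩ z →
              PrecEval f g x (suc n) z

-- Gödel numbering of codes (decoding ℕ → Code; fuel = the number itself)
decodeF : ℕ → ℕ → Code
decodeF zero    _ = zeroC
decodeF (suc k) n with unpair n
... | 0 , _ = zeroC
... | 1 , _ = succC
... | 2 , _ = idC
... | 3 , _ = fstC
... | 4 , _ = sndC
... | 5 , r = pairC (decodeF k (proj₁ (unpair r))) (decodeF k (proj₂ (unpair r)))
... | 6 , r = compC (decodeF k (proj₁ (unpair r))) (decodeF k (proj₂ (unpair r)))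
... | 7 , r = precC (decodeF k (proj₁ (unpair r))) (decodeF k (proj₂ (unpair r)))
... | 8 , r = muC (decodeF k r)
... | _ , _ = zeroC

decode : ℕ → Code
decode n = decodeF n n

_·_∈_ : ∀ {c} → ℕ → ℕ → (ℕ → Set c) → Set c
e · x ∈ C = Σ ℕ λ y → Eval (decode e) x y × C y

Sub : (ℓ : Level) → Set (lsuc ℓ)
Sub ℓ = ℕ → Set ℓ

Pred₀ : Set₁
Pred₀ = Sub lzero

_∧_ : ∀ {a c} → Sub a → Sub c → Sub (a ⊔ c)
(A ∧ C) n = Σ ℕ λ x → Σ ℕ λ y → A x × C y × n ≡ ⟨ x , y ⟩

_⇒_ : ∀ {a c} → Sub a → Sub c → Sub (a ⊔ c)
(A ⇒ C) e = ∀ x → A x → e · x ∈ C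

Family : Set₂
Family = Pred₀ → Set₁

NonemptyFamily : Family → Set₁
NonemptyFamily 𝒜 = Σ Pred₀ 𝒜

NonemptyMembers : Family → Set₁
NonemptyMembers 𝒜 = ∀ A → 𝒜 A → Σ ℕ A

_⊙_ : Family → Family → Family
(𝒜 ⊙ ℬ) C = Σ Pred₀ λ A → Σ Pred₀ λ B → 𝒜 A × ℬ B × C ≡ (A ∧ B)

Op : Set₂
Op = Pred₀ → Sub (lsuc lzero)

G : Family → Op
G 𝒜 p e = Σ Pred₀ λ A → 𝒜 A × (A ⇒ p) e

E : Op → Sub (lsuc lzero)
E f e = ∀ (p q : Pred₀) → ((p ⇒ q) ⇒ (f p ⇒ f q)) e

M* : Op → Set₁
M* f = Σ ℕ (E f) × Σ Pred₀ (λ p → Σ ℕ (f p))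

_≤_ : Op → Op → Set₁
f ≤ g = Σ ℕ λ e → ∀ (p : Pred₀) → (f p ⇒ g p) e

L : Op → Op
L g p e = ∀ (q : Pred₀) → (((p ⇒ q) ∧ (g q ⇒ q)) ⇒ q) e

_≤L_ : Op → Op → Set₁
f ≤L g = f ≤ L g

-- Realizers are indices of μ-recursive codes, and a realizer that applies the codes it receives needs a
-- universal code.  It searches for a certificate: a list of evaluation claims, each justified by the
-- claims after it, which a primitive recursive checker recognises.
--
-- With application and currying available, G 𝒜 ≤ G (𝒜 ⊙ ℬ) is realized by precomposition with the first
-- projection (A ∧ B₀ projects into A), and G ≤ L G by sending a realizer x of A → p to ⟨ u , v ⟩ ↦ v · (u ∘ x).
-- For the join, let e realize A ∧ B → p and ⟨ u , v ⟩ ∈ (p → q) ∧ (f q → q).  Currying e at a ∈ A gives a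
-- member of G ℬ p; through G ℬ ≤ L f and applied to ⟨ u , v ⟩ it lands in q.  So a ↦ … realizes A → q, a
-- member of G 𝒜 q; through G 𝒜 ≤ L f and applied to ⟨ id , v ⟩ it lands in q.

module Submission where

open import Defs renaming (_≤_ to _≤ᵣ_)
open import Data.Nat using (ℕ; zero; suc; _+_; _<_; _≤_; z≤n; s≤s; _∸_; pred)
open import Data.Nat.Properties
  using (+-suc; +-comm; +-identityʳ; suc-injective; m≤n+m; m≤m+n; ≤-trans; ≤-refl; ≤-pred; <-≤-trans;
         ≤-<-trans; <-cmp; 0≢1+n; n∸n≡0; pred[m∸n]≡m∸[1+n]; m∸n≡0⇒m≤n; ≤-antisym;
         m≤n⇒m<n∨m≡n; n≤1+n; m<n⇒m<1+n)
open import Data.Product using (Σ; _×_; _,_; proj₁; proj₂)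
open import Data.Empty using (⊥-elim)
open import Data.Sum using (inj₁; inj₂)
open import Data.Nat.Induction using (<-rec)
open import Function using (_∘_)
open import Data.Fin using (Fin; #_) renaming (zero to fzero; suc to fsuc)
open import Data.Vec using (Vec; []; _∷_; lookup)
open import Data.List using (List; []; _∷_; _++_)
open import Data.List.Membership.Propositional using (_∈_)
open import Data.List.Membership.Propositional.Properties using (∈-++⁺ˡ; ∈-++⁺ʳ)
import Data.List.Relation.Unary.Any as Any
open import Relation.Binary.Definitions using (tri<; tri≈; tri>)
open import Relation.Binary.PropositionalEquality
  using (_≡_; refl; sym; trans; cong; cong₂; subst; subst₂; module ≡-Reasoning)

π₁ π₂ : ℕ → ℕ
π₁ n = proj₁ (unpair n)
π₂ n = proj₂ (unpair n)

⟨⟩-suc : ∀ a c → ⟨ a , suc c ⟩ ≡ suc ⟨ suc a , c ⟩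
⟨⟩-suc a c rewrite +-suc a c | +-suc (tri (suc (a + c))) c = refl

⟨⟩-diagonal : ∀ c → ⟨ suc c , 0 ⟩ ≡ suc ⟨ 0 , c ⟩
⟨⟩-diagonal c rewrite +-identityʳ c | +-identityʳ (suc (c + tri c)) = cong suc (+-comm c (tri c))

unpair-suc : ∀ n {a c} → unpair n ≡ (suc a , c) → unpair (suc n) ≡ (a , suc c)
unpair-suc n eq rewrite eq = refl

unpair-diagonal : ∀ n {c} → unpair n ≡ (0 , c) → unpair (suc n) ≡ (suc c , 0)
unpair-diagonal n eq rewrite eq = refl

unpair-⟨⟩ : ∀ a c → unpair ⟨ a , c ⟩ ≡ (a , c)
unpair-⟨⟩ a c = along-diagonal (a + c) a c refl
  where
  along-diagonal : ∀ s a c → a + c ≡ s → unpair ⟨ a , c ⟩ ≡ (a , c)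
  along-diagonal s a (suc c) eq = trans (cong unpair (⟨⟩-suc a c))
    (unpair-suc ⟨ suc a , c ⟩ (along-diagonal s (suc a) c (trans (sym (+-suc a c)) eq)))
  along-diagonal (suc s) (suc a) zero eq = trans (cong unpair (⟨⟩-diagonal a))
    (unpair-diagonal ⟨ 0 , a ⟩ (along-diagonal s 0 a (suc-injective (trans (cong suc (sym (+-identityʳ a))) eq))))
  along-diagonal s zero zero eq = refl

π₁-⟨⟩ : ∀ a c → π₁ ⟨ a , c ⟩ ≡ a
π₁-⟨⟩ a c = cong proj₁ (unpair-⟨⟩ a c)

π₂-⟨⟩ : ∀ a c → π₂ ⟨ a , c ⟩ ≡ c
π₂-⟨⟩ a c = cong proj₂ (unpair-⟨⟩ a c)

⟨π₁,π₂⟩ : ∀ n → ⟨ π₁ n , π₂ n ⟩ ≡ n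
⟨π₁,π₂⟩ zero = refl
⟨π₁,π₂⟩ (suc n) with unpair n | ⟨π₁,π₂⟩ n
... | zero , c | ih = trans (⟨⟩-diagonal c) (cong suc ih)
... | suc a , c | ih = trans (⟨⟩-suc a c) (cong suc ih)

n≤tri : ∀ n → n ≤ tri n
n≤tri zero = z≤n
n≤tri (suc n) = m≤m+n (suc n) (tri n)

π₁≤ : ∀ n → π₁ n ≤ n
π₁≤ n = subst (π₁ n ≤_) (⟨π₁,π₂⟩ n)
  (≤-trans (m≤m+n (π₁ n) (π₂ n)) (≤-trans (n≤tri _) (m≤m+n _ (π₂ n))))

π₂≤ : ∀ n → π₂ n ≤ n
π₂≤ n = subst (π₂ n ≤_) (⟨π₁,π₂⟩ n) (m≤n+m (π₂ n) _)

π₂< : ∀ {n t r} → unpair n ≡ (suc t , r) → r < n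
π₂< {n} {t} {r} eq =
  subst (r <_) (trans (cong (λ p → ⟨ proj₁ p , proj₂ p ⟩) (sym eq)) (⟨π₁,π₂⟩ n)) (s≤s (m≤n+m r _))

decodeStep : (ℕ → Code) → ℕ × ℕ → Code
decodeStep d (1 , _) = succC
decodeStep d (2 , _) = idC
decodeStep d (3 , _) = fstC
decodeStep d (4 , _) = sndC
decodeStep d (5 , r) = pairC (d (π₁ r)) (d (π₂ r))
decodeStep d (6 , r) = compC (d (π₁ r)) (d (π₂ r))
decodeStep d (7 , r) = precC (d (π₁ r)) (d (π₂ r))
decodeStep d (8 , r) = muC (d r)
decodeStep d _       = zeroC

decodeF-suc : ∀ k n → decodeF (suc k) n ≡ decodeStep (decodeF k) (unpair n)
decodeF-suc k n with unpair n
... | 0 , _ = refl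
... | 1 , _ = refl
... | 2 , _ = refl
... | 3 , _ = refl
... | 4 , _ = refl
... | 5 , _ = refl
... | 6 , _ = refl
... | 7 , _ = refl
... | 8 , _ = refl
... | suc (suc (suc (suc (suc (suc (suc (suc (suc _)))))))) , _ = refl

decodeStep-cong : ∀ n {d d′ : ℕ → Code} → (∀ m → m < n → d m ≡ d′ m) →
                   decodeStep d (unpair n) ≡ decodeStep d′ (unpair n)
decodeStep-cong n {d} {d′} agree with unpair n in eq
... | 0 , r = refl
... | 1 , r = refl
... | 2 , r = refl
... | 3 , r = refl
... | 4 , r = refl
... | 5 , r = cong₂ pairC (agree _ (≤-<-trans (π₁≤ r) (π₂< eq)))
                         (agree _ (≤-<-trans (π₂≤ r) (π₂< eq)))
... | 6 , r = cong₂ compC (agree _ (≤-<-trans (π₁≤ r) (π₂< eq)))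
                         (agree _ (≤-<-trans (π₂≤ r) (π₂< eq)))
... | 7 , r = cong₂ precC (agree _ (≤-<-trans (π₁≤ r) (π₂< eq)))
                         (agree _ (≤-<-trans (π₂≤ r) (π₂< eq)))
... | 8 , r = cong muC (agree r (π₂< eq))
... | suc (suc (suc (suc (suc (suc (suc (suc (suc _)))))))) , r = refl

decodeF-fuel : ∀ {k k′ n} → n ≤ k → n ≤ k′ → decodeF k n ≡ decodeF k′ n
decodeF-fuel {zero}  {zero}   z≤n z≤n = refl
decodeF-fuel {zero}  {suc _}  z≤n _   = refl
decodeF-fuel {suc _} {zero}   _   z≤n = refl
decodeF-fuel {suc k} {suc k′} {n} n≤ n≤′ =
  trans (decodeF-suc k n)
    (trans (decodeStep-cong n (λ m m<n → decodeF-fuel (≤-pred (<-≤-trans m<n n≤)) (≤-pred (<-≤-trans m<n n≤′))))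
           (sym (decodeF-suc k′ n)))

decode-unfold : ∀ n → decode n ≡ decodeStep decode (unpair n)
decode-unfold zero    = refl
decode-unfold (suc k) =
  trans (decodeF-suc k (suc k)) (decodeStep-cong (suc k) (λ m m<n → decodeF-fuel (≤-pred m<n) ≤-refl))

decode-unpair : ∀ c {p} → unpair c ≡ p → decode c ≡ decodeStep decode p
decode-unpair c eq = trans (decode-unfold c) (cong (decodeStep decode) eq)

decode-⟨⟩ : ∀ t r → decode ⟨ t , r ⟩ ≡ decodeStep decode (t , r)
decode-⟨⟩ t r = decode-unpair ⟨ t , r ⟩ (unpair-⟨⟩ t r)

data View (c : ℕ) : Code → Set where
  zero-view  : ∀ {r}   → unpair c ≡ (0 , r) → View c zeroC
  succ-view  : ∀ {r}   → unpair c ≡ (1 , r) → View c succC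
  id-view    : ∀ {r}   → unpair c ≡ (2 , r) → View c idC
  fst-view   : ∀ {r}   → unpair c ≡ (3 , r) → View c fstC
  snd-view   : ∀ {r}   → unpair c ≡ (4 , r) → View c sndC
  pair-view  : ∀ {r}   → unpair c ≡ (5 , r) → View c (pairC (decode (π₁ r)) (decode (π₂ r)))
  comp-view  : ∀ {r}   → unpair c ≡ (6 , r) → View c (compC (decode (π₁ r)) (decode (π₂ r)))
  prec-view  : ∀ {r}   → unpair c ≡ (7 , r) → View c (precC (decode (π₁ r)) (decode (π₂ r)))
  mu-view    : ∀ {r}   → unpair c ≡ (8 , r) → View c (muC (decode r))
  junk-view  : ∀ {t r} → unpair c ≡ (9 + t , r) → View c zeroC

view : ∀ c → View c (decode c)
view c = subst (View c) (sym (decode-unfold c)) (viewStep (unpair c) refl)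
  where
  viewStep : ∀ p → unpair c ≡ p → View c (decodeStep decode p)
  viewStep (0 , _) = zero-view
  viewStep (1 , _) = succ-view
  viewStep (2 , _) = id-view
  viewStep (3 , _) = fst-view
  viewStep (4 , _) = snd-view
  viewStep (5 , _) = pair-view
  viewStep (6 , _) = comp-view
  viewStep (7 , _) = prec-view
  viewStep (8 , _) = mu-view
  viewStep (suc (suc (suc (suc (suc (suc (suc (suc (suc _)))))))) , _) = junk-view

encode : Code → ℕ
encode zeroC       = 0
encode succC       = ⟨ 1 , 0 ⟩
encode idC         = ⟨ 2 , 0 ⟩
encode fstC        = ⟨ 3 , 0 ⟩
encode sndC        = ⟨ 4 , 0 ⟩
encode (pairC f g) = ⟨ 5 , ⟨ encode f , encode g ⟩ ⟩
encode (compC f g) = ⟨ 6 , ⟨ encode f , encode g ⟩ ⟩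
encode (precC f g) = ⟨ 7 , ⟨ encode f , encode g ⟩ ⟩
encode (muC f)     = ⟨ 8 , encode f ⟩

mutual
  decode-encode : ∀ C → decode (encode C) ≡ C
  decode-encode zeroC       = refl
  decode-encode succC       = decode-⟨⟩ 1 0
  decode-encode idC         = decode-⟨⟩ 2 0
  decode-encode fstC        = decode-⟨⟩ 3 0
  decode-encode sndC        = decode-⟨⟩ 4 0
  decode-encode (pairC f g) = trans (decode-⟨⟩ 5 ⟨ encode f , encode g ⟩) (decode-encode₂ pairC f g)
  decode-encode (compC f g) = trans (decode-⟨⟩ 6 ⟨ encode f , encode g ⟩) (decode-encode₂ compC f g)
  decode-encode (precC f g) = trans (decode-⟨⟩ 7 ⟨ encode f , encode g ⟩) (decode-encode₂ precC f g)
  decode-encode (muC f)     = trans (decode-⟨⟩ 8 (encode f)) (cong muC (decode-encode f))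

  decode-encode₂ : ∀ (K : Code → Code → Code) f g →
                   K (decode (π₁ ⟨ encode f , encode g ⟩)) (decode (π₂ ⟨ encode f , encode g ⟩)) ≡ K f g
  decode-encode₂ K f g = cong₂ K (trans (cong decode (π₁-⟨⟩ (encode f) (encode g))) (decode-encode f))
                                 (trans (cong decode (π₂-⟨⟩ (encode f) (encode g))) (decode-encode g))

mutual
  Eval-functional : ∀ {C x y y′} → Eval C x y → Eval C x y′ → y ≡ y′
  Eval-functional ev-zero ev-zero = refl
  Eval-functional ev-succ ev-succ = refl
  Eval-functional ev-id   ev-id   = refl
  Eval-functional ev-fst  ev-fst  = refl
  Eval-functional ev-snd  ev-snd  = refl
  Eval-functional (ev-pair a b) (ev-pair a′ b′) = cong₂ ⟨_,_⟩ (Eval-functional a a′) (Eval-functional b b′)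
  Eval-functional (ev-comp a b) (ev-comp a′ b′) with Eval-functional a a′
  ... | refl = Eval-functional b b′
  Eval-functional (ev-prec p) (ev-prec p′) = PrecEval-functional p p′
  Eval-functional (ev-mu {n = n} z below) (ev-mu {n = n′} z′ below′) with <-cmp n n′
  ... | tri< n<n′ _ _ = ⊥-elim (0≢1+n (Eval-functional z (proj₂ (below′ n n<n′))))
  ... | tri≈ _ n≡n′ _ = n≡n′
  ... | tri> _ _ n′<n = ⊥-elim (0≢1+n (Eval-functional z′ (proj₂ (below n′ n′<n))))

  PrecEval-functional : ∀ {f g x n y y′} → PrecEval f g x n y → PrecEval f g x n y′ → y ≡ y′
  PrecEval-functional (pr-zero a) (pr-zero a′) = Eval-functional a a′
  PrecEval-functional (pr-suc p a) (pr-suc p′ a′) with PrecEval-functional p p′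
  ... | refl = Eval-functional a a′

-- Primitive recursive programs

env : ∀ {n} → Vec ℕ n → ℕ
env []      = 0
env (v ∷ ρ) = ⟨ v , env ρ ⟩

record Prog (k : ℕ) : Set where
  field
    code    : Code
    run     : Vec ℕ k → ℕ
    correct : ∀ ρ → Eval code (env ρ) (run ρ)
open Prog public

primrec : ℕ → ℕ → (ℕ → ℕ → ℕ) → ℕ
primrec zero    a s = a
primrec (suc k) a s = s k (primrec k a s)

-- In  rec c i s  the step term s sees the previous value as var 0 and the counter as var 1.
data Tm (n : ℕ) : Set where
  var   : Fin n → Tm n
  lit   : ℕ → Tm n
  suc′  : Tm n → Tm n
  fst′  : Tm n → Tm n
  snd′  : Tm n → Tm n
  pair′ : Tm n → Tm n → Tm n
  call  : ∀ {k} → Prog k → Vec (Tm n) k → Tm n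
  rec   : Tm n → Tm n → Tm (suc (suc n)) → Tm n

mutual
  ⟦_⟧ : ∀ {n} → Tm n → Vec ℕ n → ℕ
  ⟦ var i ⟧     ρ = lookup ρ i
  ⟦ lit m ⟧     ρ = m
  ⟦ suc′ t ⟧    ρ = suc (⟦ t ⟧ ρ)
  ⟦ fst′ t ⟧    ρ = π₁ (⟦ t ⟧ ρ)
  ⟦ snd′ t ⟧    ρ = π₂ (⟦ t ⟧ ρ)
  ⟦ pair′ t u ⟧ ρ = ⟨ ⟦ t ⟧ ρ , ⟦ u ⟧ ρ ⟩
  ⟦ call P ts ⟧ ρ = run P (⟦ ts ⟧* ρ)
  ⟦ rec c i s ⟧ ρ = primrec (⟦ c ⟧ ρ) (⟦ i ⟧ ρ) (λ k r → ⟦ s ⟧ (r ∷ k ∷ ρ))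

  ⟦_⟧* : ∀ {n k} → Vec (Tm n) k → Vec ℕ n → Vec ℕ k
  ⟦ [] ⟧*     ρ = []
  ⟦ t ∷ ts ⟧* ρ = ⟦ t ⟧ ρ ∷ ⟦ ts ⟧* ρ

constC : ℕ → Code
constC zero    = zeroC
constC (suc n) = compC succC (constC n)

eval-const : ∀ n {x} → Eval (constC n) x n
eval-const zero    = ev-zero
eval-const (suc n) = ev-comp (eval-const n) ev-succ

eval-fst : ∀ a b → Eval fstC ⟨ a , b ⟩ a
eval-fst a b = subst (Eval fstC ⟨ a , b ⟩) (π₁-⟨⟩ a b) ev-fst

eval-snd : ∀ a b → Eval sndC ⟨ a , b ⟩ b
eval-snd a b = subst (Eval sndC ⟨ a , b ⟩) (π₂-⟨⟩ a b) ev-snd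

varC : ∀ {n} → Fin n → Code
varC fzero    = fstC
varC (fsuc i) = compC (varC i) sndC

eval-var : ∀ {n} (i : Fin n) ρ → Eval (varC i) (env ρ) (lookup ρ i)
eval-var fzero    (v ∷ ρ) = eval-fst v (env ρ)
eval-var (fsuc i) (v ∷ ρ) = ev-comp (eval-snd v (env ρ)) (eval-var i ρ)

stepEnvC : Code
stepEnvC = pairC (compC sndC sndC) (pairC (compC fstC sndC) fstC)

eval-stepEnv : ∀ E k r → Eval stepEnvC ⟨ E , ⟨ k , r ⟩ ⟩ ⟨ r , ⟨ k , E ⟩ ⟩
eval-stepEnv E k r = ev-pair (ev-comp (eval-snd E _) (eval-snd k r))
                             (ev-pair (ev-comp (eval-snd E _) (eval-fst k r)) (eval-fst E _))

eval-prec : ∀ {F G E} a (s : ℕ → ℕ → ℕ) → Eval F E a → (∀ k r → Eval G ⟨ E , ⟨ k , r ⟩ ⟩ (s k r)) →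
            ∀ n → Eval (precC F G) ⟨ E , n ⟩ (primrec n a s)
eval-prec {F} {G} {E} a s base step n =
  ev-prec (subst₂ (λ E′ n′ → PrecEval F G E′ n′ (primrec n a s)) (sym (π₁-⟨⟩ E n)) (sym (π₂-⟨⟩ E n))
                  (iteration n))
  where
  iteration : ∀ n → PrecEval F G E n (primrec n a s)
  iteration zero    = pr-zero base
  iteration (suc n) = pr-suc (iteration n) (step n (primrec n a s))

mutual
  compile : ∀ {n} → Tm n → Code
  compile (var i)     = varC i
  compile (lit m)     = constC m
  compile (suc′ t)    = compC succC (compile t)
  compile (fst′ t)    = compC fstC (compile t)
  compile (snd′ t)    = compC sndC (compile t)
  compile (pair′ t u) = pairC (compile t) (compile u)
  compile (call P ts) = compC (code P) (compile* ts)
  compile (rec c i s) = compC (precC (compile i) (compC (compile s) stepEnvC)) (pairC idC (compile c))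

  compile* : ∀ {n k} → Vec (Tm n) k → Code
  compile* []       = zeroC
  compile* (t ∷ ts) = pairC (compile t) (compile* ts)

mutual
  compile-correct : ∀ {n} (t : Tm n) ρ → Eval (compile t) (env ρ) (⟦ t ⟧ ρ)
  compile-correct (var i)     ρ = eval-var i ρ
  compile-correct (lit m)     ρ = eval-const m
  compile-correct (suc′ t)    ρ = ev-comp (compile-correct t ρ) ev-succ
  compile-correct (fst′ t)    ρ = ev-comp (compile-correct t ρ) ev-fst
  compile-correct (snd′ t)    ρ = ev-comp (compile-correct t ρ) ev-snd
  compile-correct (pair′ t u) ρ = ev-pair (compile-correct t ρ) (compile-correct u ρ)
  compile-correct (call P ts) ρ = ev-comp (compile*-correct ts ρ) (correct P (⟦ ts ⟧* ρ))
  compile-correct (rec c i s) ρ =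
    ev-comp (ev-pair ev-id (compile-correct c ρ))
      (eval-prec (⟦ i ⟧ ρ) (λ k r → ⟦ s ⟧ (r ∷ k ∷ ρ)) (compile-correct i ρ)
        (λ k r → ev-comp (eval-stepEnv (env ρ) k r) (compile-correct s (r ∷ k ∷ ρ))) (⟦ c ⟧ ρ))

  compile*-correct : ∀ {n k} (ts : Vec (Tm n) k) ρ → Eval (compile* ts) (env ρ) (env (⟦ ts ⟧* ρ))
  compile*-correct []       ρ = ev-zero
  compile*-correct (t ∷ ts) ρ = ev-pair (compile-correct t ρ) (compile*-correct ts ρ)

prog : ∀ {k} → Tm k → Prog k
prog t = record { code = compile t ; run = ⟦ t ⟧ ; correct = compile-correct t }

unaryC : Prog 1 → Code
unaryC P = compC (code P) (pairC idC zeroC)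

eval-unary : ∀ P x → Eval (unaryC P) x (run P (x ∷ []))
eval-unary P x = ev-comp (ev-pair ev-id ev-zero) (correct P (x ∷ []))

-- A test succeeds when its value is 0.

ifzP : Prog 3
ifzP = prog (rec (var (# 0)) (var (# 1)) (var (# 4)))

ifz : ℕ → ℕ → ℕ → ℕ
ifz c a b = run ifzP (c ∷ a ∷ b ∷ [])

ifz′ : ∀ {n} → Tm n → Tm n → Tm n → Tm n
ifz′ c a b = call ifzP (c ∷ a ∷ b ∷ [])

and′ : ∀ {n} → Tm n → Tm n → Tm n
and′ a b = ifz′ a b (lit 1)

not′ : ∀ {n} → Tm n → Tm n
not′ a = ifz′ a (lit 1) (lit 0)

and-intro : ∀ {a b} → a ≡ 0 → b ≡ 0 → ifz a b 1 ≡ 0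
and-intro refl refl = refl

and-elim : ∀ a {b} → ifz a b 1 ≡ 0 → a ≡ 0 × b ≡ 0
and-elim zero b≡0 = refl , b≡0

not-intro : ∀ {a k} → a ≡ suc k → ifz a 1 0 ≡ 0
not-intro refl = refl

not-elim : ∀ a → ifz a 1 0 ≡ 0 → Σ ℕ λ k → a ≡ suc k
not-elim (suc k) _ = k , refl

predP : Prog 1
predP = prog (rec (var (# 0)) (lit 0) (var (# 1)))

pred′ : ∀ {n} → Tm n → Tm n
pred′ t = call predP (t ∷ [])

run-pred : ∀ n → run predP (n ∷ []) ≡ pred n
run-pred zero    = refl
run-pred (suc n) = refl

monusP : Prog 2
monusP = prog (rec (var (# 1)) (var (# 0)) (pred′ (var (# 0))))

run-monus : ∀ a b → run monusP (a ∷ b ∷ []) ≡ a ∸ b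
run-monus a zero    = refl
run-monus a (suc b) =
  trans (run-pred (run monusP (a ∷ b ∷ []))) (trans (cong pred (run-monus a b)) (pred[m∸n]≡m∸[1+n] a b))

equalP : Prog 2
equalP = prog (and′ (call monusP (var (# 0) ∷ var (# 1) ∷ [])) (call monusP (var (# 1) ∷ var (# 0) ∷ [])))

equal′ : ∀ {n} → Tm n → Tm n → Tm n
equal′ a b = call equalP (a ∷ b ∷ [])

equal : ℕ → ℕ → ℕ
equal a b = run equalP (a ∷ b ∷ [])

equal-refl : ∀ a → equal a a ≡ 0
equal-refl a = and-intro a∸a≡0 a∸a≡0
  where
  a∸a≡0 : run monusP (a ∷ a ∷ []) ≡ 0
  a∸a≡0 = trans (run-monus a a) (n∸n≡0 a)

equal-sound : ∀ a b → equal a b ≡ 0 → a ≡ b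
equal-sound a b eq with and-elim (run monusP (a ∷ b ∷ [])) eq
... | a∸b≡0 , b∸a≡0 = ≤-antisym (m∸n≡0⇒m≤n (trans (sym (run-monus a b)) a∸b≡0))
                                (m∸n≡0⇒m≤n (trans (sym (run-monus b a)) b∸a≡0))

-- Lists are encoded by [] = 0 and h ∷ t = suc ⟨ h , t ⟩.
data Suffix : ℕ → ℕ → Set where
  here  : ∀ {m} → Suffix (suc m) (suc m)
  there : ∀ {s m} → Suffix s (π₂ m) → Suffix s (suc m)

head tail : ℕ → ℕ
head l = π₁ (run predP (l ∷ []))
tail l = π₂ (run predP (l ∷ []))

suffix-trans : ∀ {s s′ l} → Suffix s l → Suffix s′ (tail s) → Suffix s′ l
suffix-trans here          inner = there inner
suffix-trans (there outer) inner = there (suffix-trans outer inner)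

suffix-≤ : ∀ {s l} → Suffix s l → s ≤ l
suffix-≤ here                 = ≤-refl
suffix-≤ {l = suc m} (there suffix) = ≤-trans (suffix-≤ suffix) (≤-trans (π₂≤ m) (n≤1+n m))

tail< : ∀ {s l} → Suffix s l → tail s < s
tail< (here {m})     = s≤s (π₂≤ m)
tail< (there suffix) = tail< suffix

primrec-cong : ∀ n a {s s′ : ℕ → ℕ → ℕ} → (∀ k r → s k r ≡ s′ k r) → primrec n a s ≡ primrec n a s′
primrec-cong zero    a     eq = refl
primrec-cong (suc n) a {s} eq = trans (cong (s n) (primrec-cong n a eq)) (eq n _)

module Search (P : Prog 2) where

  test : ℕ → ℕ → ℕ
  test q s = run P (q ∷ s ∷ [])

  -- the state 0 means found, suc l that the list l is still to be searched
  step : ℕ → ℕ → ℕ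
  step q zero          = zero
  step q (suc zero)    = suc zero
  step q (suc (suc m)) = ifz (test q (suc m)) 0 (suc (π₂ m))

  stepT : Tm 4
  stepT = ifz′ (var (# 0)) (lit 0)
            (ifz′ (pred′ (var (# 0))) (lit 1)
              (ifz′ (call P (var (# 2) ∷ pred′ (var (# 0)) ∷ [])) (lit 0)
                (suc′ (snd′ (pred′ (pred′ (var (# 0))))))))

  anyP : Prog 2
  anyP = prog (rec (var (# 1)) (suc′ (var (# 1))) stepT)

  search : ℕ → ℕ → ℕ → ℕ
  search q n s = primrec n s (λ _ → step q)

  run-any : ∀ q l → run anyP (q ∷ l ∷ []) ≡ search q l (suc l)
  run-any q l = primrec-cong l (suc l) stepT-step
    where
    stepT-step : ∀ k r → ⟦ stepT ⟧ (r ∷ k ∷ q ∷ l ∷ []) ≡ step q r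
    stepT-step k zero          = refl
    stepT-step k (suc zero)    = refl
    stepT-step k (suc (suc m)) = refl

  search-step : ∀ q n s → search q (suc n) s ≡ search q n (step q s)
  search-step q zero    s = refl
  search-step q (suc n) s = cong (step q) (search-step q n s)

  search-found : ∀ q n → search q n 0 ≡ 0
  search-found q zero    = refl
  search-found q (suc n) = cong (step q) (search-found q n)

  search-exhausted : ∀ q n → search q n 1 ≡ 1
  search-exhausted q zero    = refl
  search-exhausted q (suc n) = cong (step q) (search-exhausted q n)

  step-hit : ∀ q m → test q (suc m) ≡ 0 → step q (suc (suc m)) ≡ 0
  step-hit q m pass rewrite pass = refl

  step-miss : ∀ q m {k} → test q (suc m) ≡ suc k → step q (suc (suc m)) ≡ suc (π₂ m)
  step-miss q m fail rewrite fail = refl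

  search-sound : ∀ q n l → search q n (suc l) ≡ 0 → Σ ℕ λ s → Suffix s l × test q s ≡ 0
  search-sound q zero l ()
  search-sound q (suc n) zero found with trans (sym (search-exhausted q n)) (trans (sym (search-step q n 1)) found)
  ... | ()
  search-sound q (suc n) (suc m) found with test q (suc m) in result
  ... | zero  = suc m , here , result
  ... | suc _ with search-sound q n (π₂ m)
                     (trans (cong (search q n) (sym (step-miss q m result))) (trans (sym (search-step q n _)) found))
  ... | s , suffix , pass = s , there suffix , pass

  search-complete : ∀ q n {s l} → l ≤ n → Suffix s l → test q s ≡ 0 → search q n (suc l) ≡ 0
  search-complete q (suc n) {l = suc m} _ here pass =
    trans (search-step q n _) (trans (cong (search q n) (step-hit q m pass)) (search-found q n))
  search-complete q (suc n) {l = suc m} (s≤s l≤n) (there suffix) pass with test q (suc m) in result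
  ... | zero  = trans (search-step q n _) (trans (cong (search q n) (step-hit q m result)) (search-found q n))
  ... | suc _ = trans (search-step q n _) (trans (cong (search q n) (step-miss q m result))
                  (search-complete q n (≤-trans (π₂≤ m) l≤n) suffix pass))

  any-sound : ∀ q l → run anyP (q ∷ l ∷ []) ≡ 0 → Σ ℕ λ s → Suffix s l × test q s ≡ 0
  any-sound q l found = search-sound q l l (trans (sym (run-any q l)) found)

  any-complete : ∀ q {s l} → Suffix s l → test q s ≡ 0 → run anyP (q ∷ l ∷ []) ≡ 0
  any-complete q {l = l} suffix pass = trans (run-any q l) (search-complete q l ≤-refl suffix pass)

module All (P : Prog 2) where
  open Search P using (test)

  private
    module Failure = Search (prog (not′ (call P (var (# 0) ∷ var (# 1) ∷ []))))

  allP : Prog 2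
  allP = prog (not′ (call Failure.anyP (var (# 0) ∷ var (# 1) ∷ [])))

  all-sound : ∀ q l → run allP (q ∷ l ∷ []) ≡ 0 → ∀ s → Suffix s l → test q s ≡ 0
  all-sound q l ok s suffix with test q s in result
  ... | zero  = refl
  ... | suc _ with not-elim _ ok
  ... | _ , found-none = ⊥-elim (0≢1+n (trans (sym (Failure.any-complete q suffix (not-intro result))) found-none))

  all-complete : ∀ q l → (∀ s → Suffix s l → test q s ≡ 0) → run allP (q ∷ l ∷ []) ≡ 0
  all-complete q l pass with run Failure.anyP (q ∷ l ∷ []) in result
  ... | suc _ = refl
  ... | zero with Failure.any-sound q l result
  ... | s , suffix , failed with not-elim _ failed
  ... | _ , fail = ⊥-elim (0≢1+n (trans (sym (pass s suffix)) fail))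

-- Checking computation traces

-- A trace lists entries ⟨ ⟨ c , ⟨ x , y ⟩ ⟩ , w ⟩, each claiming that code c maps x to y; w is the
-- intermediate value of a composition or of a recursion step.  An entry is justified by the later entries.
claim : ℕ → ℕ → ℕ → ℕ
claim c x y = ⟨ c , ⟨ x , y ⟩ ⟩

entry : ℕ → ℕ → ℕ → ℕ → ℕ
entry c x y w = ⟨ claim c x y , w ⟩

headClaim′ : ∀ {n} → Tm n → Tm n
headClaim′ l = fst′ (fst′ (pred′ l))

cases′ : ∀ {n k} → Tm n → Vec (Tm n) k → Tm n → Tm n
cases′ t []       default = default
cases′ t (b ∷ bs) default = ifz′ t b (cases′ (pred′ t) bs default)

recordedP : Prog 2
recordedP = prog (equal′ (headClaim′ (var (# 1))) (var (# 0)))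

module Recorded = Search recordedP

recorded : ℕ → ℕ → ℕ
recorded q l = run Recorded.anyP (q ∷ l ∷ [])

recorded′ : ∀ {n} → Tm n → Tm n → Tm n → Tm n → Tm n
recorded′ l c x y = call Recorded.anyP (pair′ c (pair′ x y) ∷ l ∷ [])

-- the head entry claims a positive value of code π₁ q at input π₂ q
positiveP : Prog 2
positiveP = prog (and′ (equal′ (fst′ cl) (fst′ (var (# 0))))
                  (and′ (equal′ (fst′ (snd′ cl)) (snd′ (var (# 0)))) (not′ (snd′ (snd′ cl)))))
  where
  cl : Tm 2
  cl = headClaim′ (var (# 1))

module Positive = Search positiveP

positive : ℕ → ℕ → ℕ → ℕ
positive c x l = run Positive.anyP (⟨ c , x ⟩ ∷ l ∷ [])

positiveBelowP : Prog 4
positiveBelowP = prog (rec (var (# 3)) (lit 0)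
  (and′ (call Positive.anyP (pair′ (var (# 2)) (pair′ (var (# 3)) (var (# 1))) ∷ var (# 4) ∷ [])) (var (# 0))))

positiveBelow : ℕ → ℕ → ℕ → ℕ → ℕ
positiveBelow c x l n = run positiveBelowP (c ∷ x ∷ l ∷ n ∷ [])

-- arguments: the tag t and body r of code c (unpair c ≡ (t , r)), the claim c x ↦ y, w, and the later entries
justifiedP : Prog 7
justifiedP = prog (cases′ t
  ( y
  ∷ equal′ y (suc′ x)
  ∷ equal′ y x
  ∷ equal′ y (fst′ x)
  ∷ equal′ y (snd′ x)
  ∷ and′ (recorded′ l f x (fst′ y)) (recorded′ l g x (snd′ y))
  ∷ and′ (recorded′ l g x w) (recorded′ l f w y)
  ∷ ifz′ (snd′ x) (recorded′ l f (fst′ x) y)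
      (and′ (recorded′ l c (pair′ (fst′ x) (pred′ (snd′ x))) w)
            (recorded′ l g (pair′ (fst′ x) (pair′ (pred′ (snd′ x)) w)) y))
  ∷ and′ (recorded′ l r (pair′ x y) (lit 0)) (call positiveBelowP (r ∷ x ∷ l ∷ y ∷ []))
  ∷ []) y)
  where
  t r c x y w l f g : Tm 7
  t = var (# 0)
  r = var (# 1)
  c = var (# 2)
  x = var (# 3)
  y = var (# 4)
  w = var (# 5)
  l = var (# 6)
  f = fst′ r
  g = snd′ r

justified : ℕ × ℕ → ℕ → ℕ → ℕ → ℕ → ℕ → ℕ
justified (t , r) c x y w l = run justifiedP (t ∷ r ∷ c ∷ x ∷ y ∷ w ∷ l ∷ [])

validP : Prog 2
validP = prog (call justifiedP
  (fst′ c ∷ snd′ c ∷ c ∷ fst′ (snd′ cl) ∷ snd′ (snd′ cl) ∷ snd′ e ∷ snd′ (pred′ s) ∷ []))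
  where
  s e cl c : Tm 2
  s = var (# 1)
  e = fst′ (pred′ s)
  cl = fst′ e
  c = fst′ cl

module Valid = All validP

validTrace : ℕ → ℕ
validTrace l = run Valid.allP (0 ∷ l ∷ [])

-- the argument is ⟨ ⟨ e , x ⟩ , ⟨ y , l ⟩ ⟩: l is a valid trace recording e x ↦ y
certifiesP : Prog 1
certifiesP = prog (and′ (call Valid.allP (lit 0 ∷ l ∷ []))
                        (recorded′ l (fst′ (fst′ z)) (snd′ (fst′ z)) (fst′ (snd′ z))))
  where
  z l : Tm 1
  z = var (# 0)
  l = snd′ (snd′ z)

universalC : Code
universalC = compC fstC (muC (unaryC certifiesP))

Holds : ℕ → Set
Holds q = Eval (decode (π₁ q)) (π₁ (π₂ q)) (π₂ (π₂ q))

TrueEntries : ℕ → Set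
TrueEntries l = ∀ s → Suffix s l → Holds (π₁ (head s))

holds-at : ∀ {q c x y} → π₁ q ≡ c → π₁ (π₂ q) ≡ x → π₂ (π₂ q) ≡ y → Holds q → Eval (decode c) x y
holds-at refl refl refl h = h

claim-parts : ∀ {q} c x y → q ≡ claim c x y → π₁ q ≡ c × π₁ (π₂ q) ≡ x × π₂ (π₂ q) ≡ y
claim-parts c x y refl =
    π₁-⟨⟩ c ⟨ x , y ⟩
  , trans (cong π₁ (π₂-⟨⟩ c ⟨ x , y ⟩)) (π₁-⟨⟩ x y)
  , trans (cong π₂ (π₂-⟨⟩ c ⟨ x , y ⟩)) (π₂-⟨⟩ x y)

recorded-sound : ∀ c {x y l} → TrueEntries l → recorded (claim c x y) l ≡ 0 → Eval (decode c) x y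
recorded-sound c {x} {y} {l} true found with Recorded.any-sound (claim c x y) l found
... | s , suffix , same with equal-sound (π₁ (head s)) (claim c x y) same
... | head≡claim with claim-parts c x y head≡claim
... | same-code , same-input , same-output = holds-at {π₁ (head s)} same-code same-input same-output (true s suffix)

positive-sound : ∀ c {x l} → TrueEntries l → positive c x l ≡ 0 → Σ ℕ λ k → Eval (decode c) x (suc k)
positive-sound c {x} {l} true found with Positive.any-sound ⟨ c , x ⟩ l found
... | s , suffix , pass with π₁ (head s) | true s suffix | pass
... | q | holds | pass′ with and-elim (equal (π₁ q) (π₁ ⟨ c , x ⟩)) pass′
... | same-code , pass″ with and-elim (equal (π₁ (π₂ q)) (π₂ ⟨ c , x ⟩)) pass″
... | same-input , nonzero with not-elim (π₂ (π₂ q)) nonzero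
... | k , positive-output =
  k , holds-at {q} (trans (equal-sound (π₁ q) _ same-code) (π₁-⟨⟩ c x))
                   (trans (equal-sound (π₁ (π₂ q)) _ same-input) (π₂-⟨⟩ c x)) positive-output holds

positiveBelow-sound : ∀ c x l n → positiveBelow c x l n ≡ 0 → ∀ m → m < n → positive c ⟨ x , m ⟩ l ≡ 0
positiveBelow-sound c x l (suc n) ok m (s≤s m≤n) with and-elim (positive c ⟨ x , n ⟩ l) ok | m≤n⇒m<n∨m≡n m≤n
... | _ , below | inj₁ m<n  = positiveBelow-sound c x l n below m m<n
... | at-n , _  | inj₂ refl = at-n

record Justified-at (c x y w l : ℕ) : Set where
  field at : ∀ {p} → unpair c ≡ p → justified p c x y w l ≡ 0
open Justified-at

justified-at : ∀ c x y w l → justified (unpair c) c x y w l ≡ 0 → Justified-at c x y w l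
justified-at c x y w l ok .at eq = subst (λ p → justified p c x y w l ≡ 0) eq ok

invert-prec : ∀ {F G a n y} → Eval (precC F G) ⟨ a , n ⟩ y → PrecEval F G a n y
invert-prec {F} {G} {a} {n} {y} (ev-prec p) =
  subst₂ (λ a′ n′ → PrecEval F G a′ n′ y) (π₁-⟨⟩ a n) (π₂-⟨⟩ a n) p

prec-sound : ∀ {c r x y w l} → unpair c ≡ (7 , r) → TrueEntries l → Justified-at c x y w l →
             PrecEval (decode (π₁ r)) (decode (π₂ r)) (π₁ x) (π₂ x) y
prec-sound {c} {r} {x} {y} {w} {l} eq true ok with π₂ x | at ok eq
... | zero  | base = pr-zero (recorded-sound (π₁ r) true base)
... | suc n | steps with and-elim (recorded (claim c ⟨ π₁ x , n ⟩ w) l) steps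
... | previous , step =
  pr-suc (invert-prec (subst (λ C → Eval C ⟨ π₁ x , n ⟩ w) (decode-unpair c eq)
                             (recorded-sound c {⟨ π₁ x , n ⟩} {w} {l} true previous)))
         (recorded-sound (π₂ r) true step)

check-sound : ∀ {c C x y w l} → View c C → TrueEntries l → Justified-at c x y w l → Eval C x y
check-sound {x = x} (zero-view eq) _ ok = subst (Eval zeroC x) (sym (at ok eq)) ev-zero
check-sound {x = x} (junk-view eq) _ ok = subst (Eval zeroC x) (sym (at ok eq)) ev-zero
check-sound {x = x} {y} (succ-view eq) _ ok = subst (Eval succC x) (sym (equal-sound y _ (at ok eq))) ev-succ
check-sound {x = x} {y} (id-view eq)   _ ok = subst (Eval idC x) (sym (equal-sound y _ (at ok eq))) ev-id
check-sound {x = x} {y} (fst-view eq)  _ ok = subst (Eval fstC x) (sym (equal-sound y _ (at ok eq))) ev-fst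
check-sound {x = x} {y} (snd-view eq)  _ ok = subst (Eval sndC x) (sym (equal-sound y _ (at ok eq))) ev-snd
check-sound {x = x} {y} {l = l} (pair-view {r} eq) true ok with and-elim (recorded (claim (π₁ r) x (π₁ y)) l) (at ok eq)
... | left , right =
  subst (Eval _ x) (⟨π₁,π₂⟩ y) (ev-pair (recorded-sound (π₁ r) true left) (recorded-sound (π₂ r) true right))
check-sound {x = x} {w = w} {l} (comp-view {r} eq) true ok with and-elim (recorded (claim (π₂ r) x w) l) (at ok eq)
... | inner , outer = ev-comp (recorded-sound (π₂ r) true inner) (recorded-sound (π₁ r) true outer)
check-sound {c} {x = x} {y} {w} {l} (prec-view {r} eq) true ok = ev-prec (prec-sound {c} {r} {x} {y} {w} {l} eq true ok)
check-sound {x = x} {y} {l = l} (mu-view {r} eq) true ok with and-elim (recorded (claim r ⟨ x , y ⟩ 0) l) (at ok eq)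
... | zero-at-y , positive-below =
  ev-mu (recorded-sound r true zero-at-y)
        (λ m m<y → positive-sound r true (positiveBelow-sound r x l y positive-below m m<y))

run-valid : ∀ s → run validP (0 ∷ s ∷ []) ≡
            justified (unpair (π₁ (π₁ (head s)))) (π₁ (π₁ (head s)))
                      (π₁ (π₂ (π₁ (head s)))) (π₂ (π₂ (π₁ (head s)))) (π₂ (head s)) (tail s)
run-valid s = refl

trace-sound : ∀ l → validTrace l ≡ 0 → TrueEntries l
trace-sound l valid s = <-rec (λ s → Suffix s l → Holds (π₁ (head s))) entry-sound s
  where
  entry-sound : ∀ s → (∀ {s′} → s′ < s → Suffix s′ l → Holds (π₁ (head s′))) →
                Suffix s l → Holds (π₁ (head s))
  entry-sound s later suffix =
    check-sound (view c)
                (λ s′ suffix′ → later (≤-<-trans (suffix-≤ suffix′) (tail< suffix)) (suffix-trans suffix suffix′))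
                (justified-at c x y w (tail s) (trans (sym (run-valid s)) (Valid.all-sound 0 l valid s suffix)))
    where
    c x y w : ℕ
    c = π₁ (π₁ (head s))
    x = π₁ (π₂ (π₁ (head s)))
    y = π₂ (π₂ (π₁ (head s)))
    w = π₂ (head s)

certifies-sound : ∀ z → run certifiesP (z ∷ []) ≡ 0 → Eval (decode (π₁ (π₁ z))) (π₂ (π₁ z)) (π₁ (π₂ z))
certifies-sound z ok with and-elim (validTrace (π₂ (π₂ z))) ok
... | valid , found = recorded-sound (π₁ (π₁ z)) (trace-sound (π₂ (π₂ z)) valid) found

encodeList : List ℕ → ℕ
encodeList []      = 0
encodeList (j ∷ L) = suc ⟨ j , encodeList L ⟩

data Records (L : List ℕ) (c x y : ℕ) : Set where
  recorded-as : ∀ w → entry c x y w ∈ L → Records L c x y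

data Justified (L : List ℕ) (c : ℕ) : ℕ → ℕ → ℕ → Set where
  zeroʲ      : ∀ {r x w}   → unpair c ≡ (0 , r) → Justified L c x 0 w
  junkʲ      : ∀ {t r x w} → unpair c ≡ (9 + t , r) → Justified L c x 0 w
  succʲ      : ∀ {r x w}   → unpair c ≡ (1 , r) → Justified L c x (suc x) w
  idʲ        : ∀ {r x w}   → unpair c ≡ (2 , r) → Justified L c x x w
  fstʲ       : ∀ {r x w}   → unpair c ≡ (3 , r) → Justified L c x (π₁ x) w
  sndʲ       : ∀ {r x w}   → unpair c ≡ (4 , r) → Justified L c x (π₂ x) w
  pairʲ      : ∀ {r x a b w} → unpair c ≡ (5 , r) →
               Records L (π₁ r) x a → Records L (π₂ r) x b → Justified L c x ⟨ a , b ⟩ w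
  compʲ      : ∀ {r x y w} → unpair c ≡ (6 , r) →
               Records L (π₂ r) x w → Records L (π₁ r) w y → Justified L c x y w
  prec-zeroʲ : ∀ {r a y w} → unpair c ≡ (7 , r) → Records L (π₁ r) a y → Justified L c ⟨ a , 0 ⟩ y w
  prec-sucʲ  : ∀ {r a n y w} → unpair c ≡ (7 , r) →
               Records L c ⟨ a , n ⟩ w → Records L (π₂ r) ⟨ a , ⟨ n , w ⟩ ⟩ y → Justified L c ⟨ a , suc n ⟩ y w
  muʲ        : ∀ {r x y w} → unpair c ≡ (8 , r) → Records L r ⟨ x , y ⟩ 0 →
               (∀ m → m < y → Σ ℕ λ k → Records L r ⟨ x , m ⟩ (suc k)) → Justified L c x y w

Justified-mono : ∀ {L L′ c x y w} → (∀ {c x y} → Records L c x y → Records L′ c x y) →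
                 Justified L c x y w → Justified L′ c x y w
Justified-mono L⊆L′ (zeroʲ eq)           = zeroʲ eq
Justified-mono L⊆L′ (junkʲ eq)           = junkʲ eq
Justified-mono L⊆L′ (succʲ eq)           = succʲ eq
Justified-mono L⊆L′ (idʲ eq)             = idʲ eq
Justified-mono L⊆L′ (fstʲ eq)            = fstʲ eq
Justified-mono L⊆L′ (sndʲ eq)            = sndʲ eq
Justified-mono L⊆L′ (pairʲ eq left right) = pairʲ eq (L⊆L′ left) (L⊆L′ right)
Justified-mono L⊆L′ (compʲ eq inner outer) = compʲ eq (L⊆L′ inner) (L⊆L′ outer)
Justified-mono L⊆L′ (prec-zeroʲ eq base) = prec-zeroʲ eq (L⊆L′ base)
Justified-mono L⊆L′ (prec-sucʲ {a = a} {n} eq previous step) = prec-sucʲ {a = a} {n} eq (L⊆L′ previous) (L⊆L′ step)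
Justified-mono L⊆L′ (muʲ eq zero-at-y below) =
  muʲ eq (L⊆L′ zero-at-y) (λ m m<y → proj₁ (below m m<y) , L⊆L′ (proj₂ (below m m<y)))

data Trace : List ℕ → Set where
  []  : Trace []
  _∷_ : ∀ {L c x y w} → Justified L c x y w → Trace L → Trace (entry c x y w ∷ L)

Records-++ˡ : ∀ {L} L′ {c x y} → Records L c x y → Records (L ++ L′) c x y
Records-++ˡ L′ (recorded-as w ∈L) = recorded-as w (∈-++⁺ˡ ∈L)

Records-++ʳ : ∀ L {L′ c x y} → Records L′ c x y → Records (L ++ L′) c x y
Records-++ʳ L (recorded-as w ∈L′) = recorded-as w (∈-++⁺ʳ L ∈L′)

Trace-++ : ∀ {L L′} → Trace L → Trace L′ → Trace (L ++ L′)
Trace-++         []       t′ = t′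
Trace-++ {L′ = L′} (j ∷ t) t′ = Justified-mono (Records-++ˡ L′) j ∷ Trace-++ t t′

Certificate : ℕ → ℕ → ℕ → Set
Certificate c x y = Σ (List ℕ) λ L → Trace L × Records L c x y

extend : ∀ {L c x y} w → Trace L → Justified L c x y w → Certificate c x y
extend w t j = _ ∷ _ , j ∷ t , recorded-as w (Any.here refl)

merge : ∀ {c x y c′ x′ y′} → Certificate c x y → Certificate c′ x′ y′ →
        Σ (List ℕ) λ L → Trace L × Records L c x y × Records L c′ x′ y′
merge (L , t , r) (L′ , t′ , r′) = L ++ L′ , Trace-++ t t′ , Records-++ˡ L′ r , Records-++ʳ L r′

mutual
  certify : ∀ {c C x y} → View c C → Eval C x y → Certificate c x y
  certify (zero-view eq) ev-zero = extend 0 [] (zeroʲ eq)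
  certify (junk-view eq) ev-zero = extend 0 [] (junkʲ eq)
  certify (succ-view eq) ev-succ = extend 0 [] (succʲ eq)
  certify (id-view eq)   ev-id   = extend 0 [] (idʲ eq)
  certify (fst-view eq)  ev-fst  = extend 0 [] (fstʲ eq)
  certify (snd-view eq)  ev-snd  = extend 0 [] (sndʲ eq)
  certify (pair-view eq) (ev-pair left right) with merge (certify (view _) left) (certify (view _) right)
  ... | _ , t , rₗ , rᵣ = extend 0 t (pairʲ eq rₗ rᵣ)
  certify (comp-view eq) (ev-comp {y = w} inner outer) with merge (certify (view _) inner) (certify (view _) outer)
  ... | _ , t , rᵢ , rₒ = extend w t (compʲ eq rᵢ rₒ)
  certify {c} {y = y} (prec-view eq) (ev-prec {x = x} p) =
    subst (λ x → Certificate c x y) (⟨π₁,π₂⟩ x) (certify-prec eq p)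
  certify (mu-view {r} eq) (ev-mu {x = x} {n = y} zero-at-y below)
    with certify (view r) zero-at-y | certify-below {r} {x} below y ≤-refl
  ... | L₀ , t₀ , r₀ | L , t , rs =
    extend 0 (Trace-++ t₀ t)
      (muʲ eq (Records-++ˡ L r₀) (λ m m<y → proj₁ (rs m m<y) , Records-++ʳ L₀ (proj₂ (rs m m<y))))

  certify-below : ∀ {r x n} → (∀ m → m < n → Σ ℕ λ k → Eval (decode r) ⟨ x , m ⟩ (suc k)) → ∀ k → k ≤ n →
                  Σ (List ℕ) λ L → Trace L × (∀ m → m < k → Σ ℕ λ v → Records L r ⟨ x , m ⟩ (suc v))
  certify-below below zero    _   = [] , [] , λ m ()
  certify-below {r} {x} below (suc k) k<n
    with certify-below {r} {x} below k (≤-trans (n≤1+n k) k<n) | certify (view r) (proj₂ (below k k<n))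
  ... | L , t , rs | L′ , t′ , r′ = L ++ L′ , Trace-++ t t′ , records-below
    where
    records-below : ∀ m → m < suc k → Σ ℕ λ v → Records (L ++ L′) r ⟨ x , m ⟩ (suc v)
    records-below m m<1+k with m≤n⇒m<n∨m≡n (≤-pred m<1+k)
    ... | inj₁ m<k  = proj₁ (rs m m<k) , Records-++ˡ L′ (proj₂ (rs m m<k))
    ... | inj₂ refl = proj₁ (below k k<n) , Records-++ʳ L r′

  certify-prec : ∀ {c r a n y} → unpair c ≡ (7 , r) → PrecEval (decode (π₁ r)) (decode (π₂ r)) a n y →
                 Certificate c ⟨ a , n ⟩ y
  certify-prec eq (pr-zero base) with certify (view _) base
  ... | _ , t , r = extend 0 t (prec-zeroʲ eq r)
  certify-prec {a = a} eq (pr-suc {n} {w} previous step) with merge (certify-prec eq previous) (certify (view _) step)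
  ... | _ , t , rₚ , rₛ = extend w t (prec-sucʲ {a = a} {n} eq rₚ rₛ)

member-suffix : ∀ {j L} → j ∈ L → Σ ℕ λ s → Suffix s (encodeList L) × head s ≡ j
member-suffix {j} {.j ∷ L} (Any.here refl) = suc ⟨ j , encodeList L ⟩ , here , π₁-⟨⟩ j (encodeList L)
member-suffix {L = j′ ∷ L} (Any.there j∈L) with member-suffix j∈L
... | s , suffix , head≡j = s , there (subst (Suffix s) (sym (π₂-⟨⟩ j′ (encodeList L))) suffix) , head≡j

recorded-claim : ∀ {L c x y} → Records L c x y → Σ ℕ λ s → Suffix s (encodeList L) × π₁ (head s) ≡ claim c x y
recorded-claim {c = c} {x} {y} (recorded-as w ∈L) with member-suffix ∈L
... | s , suffix , head≡entry = s , suffix , trans (cong π₁ head≡entry) (π₁-⟨⟩ (claim c x y) w)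

equal-≡ : ∀ {a b} → a ≡ b → equal a b ≡ 0
equal-≡ {a} refl = equal-refl a

records-accept : ∀ {L c x y} → Records L c x y → recorded (claim c x y) (encodeList L) ≡ 0
records-accept {c = c} {x} {y} r with recorded-claim r
... | s , suffix , is-claim = Recorded.any-complete (claim c x y) suffix (equal-≡ is-claim)

positive-accept : ∀ {L c x k} → Records L c x (suc k) → positive c x (encodeList L) ≡ 0
positive-accept {c = c} {x} {k} r with recorded-claim r
... | s , suffix , is-claim with claim-parts c x (suc k) is-claim
... | same-code , same-input , positive-output =
  Positive.any-complete ⟨ c , x ⟩ suffix
    (and-intro (equal-≡ (trans same-code (sym (π₁-⟨⟩ c x))))
               (and-intro (equal-≡ (trans same-input (sym (π₂-⟨⟩ c x)))) (not-intro positive-output)))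

positiveBelow-accept : ∀ {L r x} n → (∀ m → m < n → Σ ℕ λ k → Records L r ⟨ x , m ⟩ (suc k)) →
                       positiveBelow r x (encodeList L) n ≡ 0
positiveBelow-accept zero    _     = refl
positiveBelow-accept {L} {r} {x} (suc n) below =
  and-intro (positive-accept (proj₂ (below n ≤-refl)))
            (positiveBelow-accept {L} {r} {x} n (λ m m<n → below m (m<n⇒m<1+n m<n)))

justified-from : ∀ c x y w l {p} → unpair c ≡ p → justified p c x y w l ≡ 0 → justified (unpair c) c x y w l ≡ 0
justified-from c x y w l eq ok = subst (λ p → justified p c x y w l ≡ 0) (sym eq) ok

pairJustified : ℕ → ℕ → ℕ → ℕ → ℕ → ℕ
pairJustified r x a b l = ifz (recorded (claim (π₁ r) x a) l) (recorded (claim (π₂ r) x b) l) 1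

precJustified : ℕ → ℕ → ℕ → ℕ → ℕ → ℕ → ℕ → ℕ
precJustified r c a n y w l =
  ifz n (recorded (claim (π₁ r) a y) l)
        (ifz (recorded (claim c ⟨ a , run predP (n ∷ []) ⟩ w) l)
             (recorded (claim (π₂ r) ⟨ a , ⟨ run predP (n ∷ []) , w ⟩ ⟩ y) l) 1)

justified-accept : ∀ {L c x y w} → Justified L c x y w → justified (unpair c) c x y w (encodeList L) ≡ 0
justified-accept {L} {c} {x} {w = w} (zeroʲ eq) = justified-from c x 0 w (encodeList L) eq refl
justified-accept {L} {c} {x} {w = w} (junkʲ eq) = justified-from c x 0 w (encodeList L) eq refl
justified-accept {L} {c} {x} {w = w} (succʲ eq) = justified-from c x (suc x) w (encodeList L) eq (equal-refl (suc x))
justified-accept {L} {c} {x} {w = w} (idʲ eq)   = justified-from c x x w (encodeList L) eq (equal-refl x)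
justified-accept {L} {c} {x} {w = w} (fstʲ eq)  = justified-from c x (π₁ x) w (encodeList L) eq (equal-refl (π₁ x))
justified-accept {L} {c} {x} {w = w} (sndʲ eq)  = justified-from c x (π₂ x) w (encodeList L) eq (equal-refl (π₂ x))
justified-accept {L} {c} {x} {w = w} (pairʲ {r} {a = a} {b} eq left right) = justified-from c x ⟨ a , b ⟩ w (encodeList L) eq
  (subst₂ (λ a′ b′ → pairJustified r x a′ b′ (encodeList L) ≡ 0) (sym (π₁-⟨⟩ a b)) (sym (π₂-⟨⟩ a b))
          (and-intro (records-accept left) (records-accept right)))
justified-accept {L} {c} {x} {y} {w} (compʲ eq inner outer) =
  justified-from c x y w (encodeList L) eq (and-intro (records-accept inner) (records-accept outer))
justified-accept {L} {c} {y = y} {w} (prec-zeroʲ {r} {a} eq base) = justified-from c ⟨ a , 0 ⟩ y w (encodeList L) eq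
  (subst₂ (λ a′ n′ → precJustified r c a′ n′ y w (encodeList L) ≡ 0) (sym (π₁-⟨⟩ a 0)) (sym (π₂-⟨⟩ a 0))
          (records-accept base))
justified-accept {L} {c} {y = y} {w} (prec-sucʲ {r} {a} {n} eq previous step) =
  justified-from c ⟨ a , suc n ⟩ y w (encodeList L) eq
    (subst₂ (λ a′ n′ → precJustified r c a′ n′ y w (encodeList L) ≡ 0)
            (sym (π₁-⟨⟩ a (suc n))) (sym (π₂-⟨⟩ a (suc n)))
            (and-intro (records-accept previous) (records-accept step)))
justified-accept {L} {c} {x} {y} {w} (muʲ {r} eq zero-at-y below) =
  justified-from c x y w (encodeList L) eq (and-intro (records-accept zero-at-y) (positiveBelow-accept {L} {r} {x} y below))

justified-cong : ∀ {c x y w l c′ x′ y′ w′ l′} → c ≡ c′ → x ≡ x′ → y ≡ y′ → w ≡ w′ → l ≡ l′ →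
                 justified (unpair c) c x y w l ≡ justified (unpair c′) c′ x′ y′ w′ l′
justified-cong refl refl refl refl refl = refl

entries-valid : ∀ {L} → Trace L → ∀ s → Suffix s (encodeList L) → run validP (0 ∷ s ∷ []) ≡ 0
entries-valid (_∷_ {L} {c} {x} {y} {w} j t) _ here
  with claim-parts c x y (trans (cong π₁ (π₁-⟨⟩ (entry c x y w) (encodeList L))) (π₁-⟨⟩ (claim c x y) w))
... | same-code , same-input , same-output =
  trans (run-valid (suc ⟨ entry c x y w , encodeList L ⟩)) (trans (justified-cong same-code same-input same-output
          (trans (cong π₂ (π₁-⟨⟩ (entry c x y w) (encodeList L))) (π₂-⟨⟩ (claim c x y) w))
          (π₂-⟨⟩ (entry c x y w) (encodeList L)))
        (justified-accept j))
entries-valid (_∷_ {L} {c} {x} {y} {w} j t) s (there suffix) =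
  entries-valid t s (subst (Suffix s) (π₂-⟨⟩ (entry c x y w) (encodeList L)) suffix)

trace-accept : ∀ {L} → Trace L → validTrace (encodeList L) ≡ 0
trace-accept t = Valid.all-complete 0 _ (entries-valid t)

certifiesAt : ℕ → ℕ → ℕ → ℕ → ℕ
certifiesAt e x y l = ifz (validTrace l) (recorded (claim e x y) l) 1

certifies-⟨⟩ : ∀ e x y l → run certifiesP (⟨ ⟨ e , x ⟩ , ⟨ y , l ⟩ ⟩ ∷ []) ≡ certifiesAt e x y l
certifies-⟨⟩ e x y l =
  begin
    certifiesAt (π₁ (π₁ z)) (π₂ (π₁ z)) (π₁ (π₂ z)) (π₂ (π₂ z))
      ≡⟨ cong₂ (λ u v → certifiesAt (π₁ u) (π₂ u) (π₁ v) (π₂ v)) (π₁-⟨⟩ ⟨ e , x ⟩ ⟨ y , l ⟩) (π₂-⟨⟩ ⟨ e , x ⟩ ⟨ y , l ⟩) ⟩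
    certifiesAt (π₁ ⟨ e , x ⟩) (π₂ ⟨ e , x ⟩) (π₁ ⟨ y , l ⟩) (π₂ ⟨ y , l ⟩)
      ≡⟨ cong₂ (λ e′ x′ → certifiesAt e′ x′ (π₁ ⟨ y , l ⟩) (π₂ ⟨ y , l ⟩)) (π₁-⟨⟩ e x) (π₂-⟨⟩ e x) ⟩
    certifiesAt e x (π₁ ⟨ y , l ⟩) (π₂ ⟨ y , l ⟩)
      ≡⟨ cong₂ (certifiesAt e x) (π₁-⟨⟩ y l) (π₂-⟨⟩ y l) ⟩
    certifiesAt e x y l
  ∎
  where
  open ≡-Reasoning
  z : ℕ
  z = ⟨ ⟨ e , x ⟩ , ⟨ y , l ⟩ ⟩

certificate-accept : ∀ {e x y} → Certificate e x y → Σ ℕ λ n → run certifiesP (⟨ ⟨ e , x ⟩ , n ⟩ ∷ []) ≡ 0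
certificate-accept {e} {x} {y} (L , t , r) =
  ⟨ y , encodeList L ⟩ , trans (certifies-⟨⟩ e x y (encodeList L)) (and-intro (trace-accept t) (records-accept r))

-- The universal code

least-zero : ∀ (f : ℕ → ℕ) n → f n ≡ 0 → Σ ℕ λ m → f m ≡ 0 × (∀ k → k < m → Σ ℕ λ v → f k ≡ suc v)
least-zero f zero    zero-at-n = 0 , zero-at-n , λ k ()
least-zero f (suc n) zero-at-n with f 0 in f0
... | zero  = 0 , f0 , λ k ()
... | suc v with least-zero (f ∘ suc) n zero-at-n
... | m , zero-at-m , below = suc m , zero-at-m , positive-below
  where
  positive-below : ∀ k → k < suc m → Σ ℕ λ v → f k ≡ suc v
  positive-below zero    _         = v , f0
  positive-below (suc k) (s≤s k<m) = below k k<m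

eval-universal : ∀ e {x y} → Eval (decode e) x y → Eval universalC ⟨ e , x ⟩ y
eval-universal e {x} {y} ev with certificate-accept (certify (view e) ev)
... | n₀ , accepted with least-zero (λ n → run certifiesP (⟨ ⟨ e , x ⟩ , n ⟩ ∷ [])) n₀ accepted
... | n , first , earlier =
  ev-comp (ev-mu (subst (Eval (unaryC certifiesP) ⟨ ⟨ e , x ⟩ , n ⟩) first (eval-unary certifiesP ⟨ ⟨ e , x ⟩ , n ⟩))
                 (λ m m<n → proj₁ (earlier m m<n)
                          , subst (Eval (unaryC certifiesP) ⟨ ⟨ e , x ⟩ , m ⟩) (proj₂ (earlier m m<n))
                                  (eval-unary certifiesP ⟨ ⟨ e , x ⟩ , m ⟩)))
          (subst (Eval fstC n) (Eval-functional found ev) ev-fst)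
  where
  found : Eval (decode e) x (π₁ n)
  found = subst₂ (λ e′ x′ → Eval (decode e′) x′ (π₁ n)) (π₁-⟨⟩ e x) (π₂-⟨⟩ e x)
            (subst₂ (λ u v → Eval (decode (π₁ u)) (π₂ u) (π₁ v)) (π₁-⟨⟩ ⟨ e , x ⟩ n) (π₂-⟨⟩ ⟨ e , x ⟩ n)
              (certifies-sound ⟨ ⟨ e , x ⟩ , n ⟩ first))

Lands : ∀ {ℓ} → Code → ℕ → (ℕ → Set ℓ) → Set ℓ
Lands C x P = Σ ℕ λ y → Eval C x y × P y

constIndexP : Prog 1
constIndexP = prog (rec (var (# 0)) (lit 0) (pair′ (lit 6) (pair′ (lit (encode succC)) (var (# 0)))))

run-constIndex : ∀ a → run constIndexP (a ∷ []) ≡ encode (constC a)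
run-constIndex zero    = refl
run-constIndex (suc a) = cong (λ r → ⟨ 6 , ⟨ encode succC , r ⟩ ⟩) (run-constIndex a)

-- Kept opaque: the numerals encoding codes that contain universalC are far too large to be unfolded.
opaque
  index : Code → ℕ
  index = encode

  curryP : Code → Prog 1
  curryP H = prog (pair′ (lit 6) (pair′ (lit (index H))
                    (pair′ (lit 5) (pair′ (call constIndexP (var (# 0) ∷ [])) (lit (index idC))))))

  decode-index : ∀ C → decode (index C) ≡ C
  decode-index = decode-encode

  curry : Code → ℕ → ℕ
  curry H a = index (compC H (pairC (constC a) idC))

  decode-curry : ∀ H a → decode (curry H a) ≡ compC H (pairC (constC a) idC)
  decode-curry H a = decode-index (compC H (pairC (constC a) idC))

  run-curry : ∀ H a → run (curryP H) (a ∷ []) ≡ curry H a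
  run-curry H a = cong (λ r → ⟨ 6 , ⟨ encode H , ⟨ 5 , ⟨ r , encode idC ⟩ ⟩ ⟩ ⟩) (run-constIndex a)

index-lands : ∀ {ℓ} C {x} {P : ℕ → Set ℓ} → Lands C x P → index C · x ∈ P
index-lands C {x} (y , ev , py) = y , subst (λ C′ → Eval C′ x y) (sym (decode-index C)) ev , py

applyC : Code → Code → Code
applyC F A = compC universalC (pairC F A)

eval-apply : ∀ {F A x e a y} → Eval F x e → Eval A x a → Eval (decode e) a y → Eval (applyC F A) x y
eval-apply {e = e} evF evA ev = ev-comp (ev-pair evF evA) (eval-universal e ev)

apply-lands : ∀ {ℓ} {F A x e a} {P : ℕ → Set ℓ} → Eval F x e → Eval A x a → e · a ∈ P → Lands (applyC F A) x P
apply-lands evF evA (y , ev , py) = y , eval-apply evF evA ev , py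

curry-lands : ∀ {ℓ} H a z {P : ℕ → Set ℓ} → Lands H ⟨ a , z ⟩ P → curry H a · z ∈ P
curry-lands H a z (y , ev , py) =
  y , subst (λ C → Eval C z y) (sym (decode-curry H a)) (ev-comp (ev-pair (eval-const a) ev-id) ev) , py

curryC : Code → Code
curryC H = unaryC (curryP H)

eval-curry : ∀ H a → Eval (curryC H) a (curry H a)
eval-curry H a = subst (Eval (curryC H) a) (run-curry H a) (eval-unary (curryP H) a)

-- Realizability

id-⇒ : ∀ {ℓ} {P : ℕ → Set ℓ} → (P ⇒ P) (index idC)
id-⇒ x Px = index-lands idC (x , ev-id , Px)

L-collapse : ∀ {g : Op} {q x v} → L g q x → (g q ⇒ q) v → x · ⟨ index idC , v ⟩ ∈ q
L-collapse {q = q} {v = v} x∈Lgq v∈gq⇒q = x∈Lgq q ⟨ index idC , v ⟩ (index idC , v , id-⇒ , v∈gq⇒q , refl)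

≤ᵣ-trans : ∀ {f g h : Op} → f ≤ᵣ g → g ≤ᵣ h → f ≤ᵣ h
≤ᵣ-trans {f} {g} {h} (d₁ , f≤g) (d₂ , g≤h) = index composite , realizes
  where
  composite : Code
  composite = applyC (constC d₂) (applyC (constC d₁) idC)

  realizes : ∀ p → (f p ⇒ h p) (index composite)
  realizes p e fe =
    let y , ev , gy = f≤g p e fe
    in index-lands composite (apply-lands (eval-const d₂) (eval-apply (eval-const d₁) ev-id ev) (g≤h p y gy))

∧-fst : ∀ {A B : Pred₀} {z} → (A ∧ B) z → Σ ℕ λ a → A a × Eval fstC z a
∧-fst (a , b , Aa , _ , refl) = a , Aa , eval-fst a b

∧-snd : ∀ {A B : Pred₀} {z} → (A ∧ B) z → Σ ℕ λ b → B b × Eval sndC z b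
∧-snd (a , b , _ , Bb , refl) = b , Bb , eval-snd a b

Refines : Family → Code → Family → Set₁
Refines 𝒳 P 𝒴 = ∀ A → 𝒳 A → Σ Pred₀ λ C → 𝒴 C × (∀ z → C z → Σ ℕ λ a → A a × Eval P z a)

⊙-refinesˡ : ∀ {𝒜 ℬ B₀} → ℬ B₀ → Refines 𝒜 fstC (𝒜 ⊙ ℬ)
⊙-refinesˡ {B₀ = B₀} B₀∈ℬ A A∈𝒜 = A ∧ B₀ , (A , B₀ , A∈𝒜 , B₀∈ℬ , refl) , λ z → ∧-fst {A} {B₀} {z}

⊙-refinesʳ : ∀ {𝒜 ℬ A₀} → 𝒜 A₀ → Refines ℬ sndC (𝒜 ⊙ ℬ)
⊙-refinesʳ {A₀ = A₀} A₀∈𝒜 B B∈ℬ = A₀ ∧ B , (A₀ , B , A₀∈𝒜 , B∈ℬ , refl) , λ z → ∧-snd {A₀} {B} {z}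

G-≤ᵣ : ∀ {𝒳 𝒴 P} → Refines 𝒳 P 𝒴 → G 𝒳 ≤ᵣ G 𝒴
G-≤ᵣ {𝒳} {𝒴} {P} refine = index (curryC H) , realizes
  where
  H : Code
  H = applyC fstC (compC P sndC)

  realizes : ∀ p → (G 𝒳 p ⇒ G 𝒴 p) (index (curryC H))
  realizes p e (A , A∈𝒳 , e∈A⇒p) =
    let C , C∈𝒴 , into-A = refine A A∈𝒳
        on-C : (C ⇒ p) (curry H e)
        on-C z Cz = let a , Aa , evP = into-A z Cz
                    in curry-lands H e z (apply-lands (eval-fst e z) (ev-comp (eval-snd e z) evP) (e∈A⇒p a Aa))
    in index-lands (curryC H) (curry H e , eval-curry H e , C , C∈𝒴 , on-C)

G-≤ᵣ-L : ∀ 𝒴 → G 𝒴 ≤ᵣ L (G 𝒴)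
G-≤ᵣ-L 𝒴 = index (curryC H₂) , realizes
  where
  -- ⟨ ⟨ x , u ⟩ , z ⟩ ↦ u · (x · z)
  H₁ : Code
  H₁ = applyC (compC sndC fstC) (applyC (compC fstC fstC) sndC)
  -- ⟨ x , ⟨ u , v ⟩ ⟩ ↦ v · curry H₁ ⟨ x , u ⟩
  H₂ : Code
  H₂ = applyC (compC sndC sndC) (compC (curryC H₁) (pairC fstC (compC fstC sndC)))

  realizes : ∀ p → (G 𝒴 p ⇒ L (G 𝒴) p) (index (curryC H₂))
  realizes p x (A , A∈𝒴 , x∈A⇒p) = index-lands (curryC H₂) (curry H₂ x , eval-curry H₂ x , in-L)
    where
    in-L : L (G 𝒴) p (curry H₂ x)
    in-L q _ (u , v , u∈p⇒q , v∈Gq⇒q , refl) =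
      curry-lands H₂ x ⟨ u , v ⟩
        (apply-lands (ev-comp (eval-snd x ⟨ u , v ⟩) (eval-snd u v))
                     (ev-comp (ev-pair (eval-fst x ⟨ u , v ⟩) (ev-comp (eval-snd x ⟨ u , v ⟩) (eval-fst u v)))
                              (eval-curry H₁ ⟨ x , u ⟩))
                     (v∈Gq⇒q (curry H₁ ⟨ x , u ⟩) (A , A∈𝒴 , on-A)))
      where
      then-u : ∀ z → x · z ∈ p → Lands H₁ ⟨ ⟨ x , u ⟩ , z ⟩ q
      then-u z (y , ev , py) = apply-lands (ev-comp (eval-fst ⟨ x , u ⟩ z) (eval-snd x u))
                                           (eval-apply (ev-comp (eval-fst ⟨ x , u ⟩ z) (eval-fst x u)) (eval-snd ⟨ x , u ⟩ z) ev)
                                           (u∈p⇒q y py)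

      on-A : (A ⇒ q) (curry H₁ ⟨ x , u ⟩)
      on-A z Az = curry-lands H₁ ⟨ x , u ⟩ z (then-u z (x∈A⇒p z Az))

G-⊙-≤L : ∀ 𝒜 ℬ (f : Op) → G 𝒜 ≤L f → G ℬ ≤L f → G (𝒜 ⊙ ℬ) ≤L f
G-⊙-≤L 𝒜 ℬ f (α , G𝒜≤Lf) (β , Gℬ≤Lf) = index (curryC H₅) , realizes
  where
  -- ⟨ ⟨ e , a ⟩ , b ⟩ ↦ e · ⟨ a , b ⟩
  H₃ : Code
  H₃ = applyC (compC fstC fstC) (pairC (compC sndC fstC) sndC)
  -- ⟨ ⟨ e , n ⟩ , a ⟩ ↦ (β · curry H₃ ⟨ e , a ⟩) · n
  H₄ : Code
  H₄ = applyC (applyC (constC β) (compC (curryC H₃) (pairC (compC fstC fstC) sndC))) (compC sndC fstC)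
  -- ⟨ e , n ⟩ ↦ (α · curry H₄ ⟨ e , n ⟩) · ⟨ index idC , π₂ n ⟩
  H₅ : Code
  H₅ = applyC (applyC (constC α) (curryC H₄)) (pairC (constC (index idC)) (compC sndC sndC))

  realizes : ∀ p → (G (𝒜 ⊙ ℬ) p ⇒ L f p) (index (curryC H₅))
  realizes p e (_ , (A , B , A∈𝒜 , B∈ℬ , refl) , e∈A∧B⇒p) =
    index-lands (curryC H₅) (curry H₅ e , eval-curry H₅ e , in-L)
    where
    section : ∀ {a} → A a → (B ⇒ p) (curry H₃ ⟨ e , a ⟩)
    section {a} Aa b Bb =
      curry-lands H₃ ⟨ e , a ⟩ b (apply-lands (ev-comp (eval-fst ⟨ e , a ⟩ b) (eval-fst e a))
                                              (ev-pair (ev-comp (eval-fst ⟨ e , a ⟩ b) (eval-snd e a)) (eval-snd ⟨ e , a ⟩ b))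
                                              (e∈A∧B⇒p ⟨ a , b ⟩ (a , b , Aa , Bb , refl)))

    in-L : L f p (curry H₅ e)
    in-L q _ (u , v , u∈p⇒q , v∈fq⇒q , refl) = finish (G𝒜≤Lf q (curry H₄ ⟨ e , ⟨ u , v ⟩ ⟩) (A , A∈𝒜 , on-A))
      where
      through-β : ∀ a → β · curry H₃ ⟨ e , a ⟩ ∈ L f p → Lands H₄ ⟨ ⟨ e , ⟨ u , v ⟩ ⟩ , a ⟩ q
      through-β a (y , evβ , y∈Lfp) =
        apply-lands (eval-apply (eval-const β)
                                (ev-comp (ev-pair (ev-comp (eval-fst ⟨ e , ⟨ u , v ⟩ ⟩ a) (eval-fst e ⟨ u , v ⟩))
                                                  (eval-snd ⟨ e , ⟨ u , v ⟩ ⟩ a))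
                                         (eval-curry H₃ ⟨ e , a ⟩))
                                evβ)
                    (ev-comp (eval-fst ⟨ e , ⟨ u , v ⟩ ⟩ a) (eval-snd e ⟨ u , v ⟩))
                    (y∈Lfp q ⟨ u , v ⟩ (u , v , u∈p⇒q , v∈fq⇒q , refl))

      on-A : (A ⇒ q) (curry H₄ ⟨ e , ⟨ u , v ⟩ ⟩)
      on-A a Aa =
        curry-lands H₄ ⟨ e , ⟨ u , v ⟩ ⟩ a (through-β a (Gℬ≤Lf p (curry H₃ ⟨ e , a ⟩) (B , B∈ℬ , section Aa)))

      finish : α · curry H₄ ⟨ e , ⟨ u , v ⟩ ⟩ ∈ L f q → curry H₅ e · ⟨ u , v ⟩ ∈ q
      finish (y , evα , y∈Lfq) =
        curry-lands H₅ e ⟨ u , v ⟩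
          (apply-lands (eval-apply (eval-const α) (eval-curry H₄ ⟨ e , ⟨ u , v ⟩ ⟩) evα)
                       (ev-pair (eval-const (index idC)) (ev-comp (eval-snd e ⟨ u , v ⟩) (eval-snd u v)))
                       (L-collapse {f} {q} {y} {v} y∈Lfq v∈fq⇒q))

proposition5p12 : (𝒜 ℬ : Family) →
    NonemptyFamily 𝒜 → NonemptyFamily ℬ →
    NonemptyMembers 𝒜 → NonemptyMembers ℬ →
    (G 𝒜 ≤L G (𝒜 ⊙ ℬ)) × (G ℬ ≤L G (𝒜 ⊙ ℬ)) ×
    ((f : Op) → M* f → G 𝒜 ≤L f → G ℬ ≤L f → G (𝒜 ⊙ ℬ) ≤L f)
proposition5p12 𝒜 ℬ (_ , A₀∈𝒜) (_ , B₀∈ℬ) _ _ =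
    ≤ᵣ-trans (G-≤ᵣ (⊙-refinesˡ {𝒜} {ℬ} B₀∈ℬ)) (G-≤ᵣ-L (𝒜 ⊙ ℬ))
  , ≤ᵣ-trans (G-≤ᵣ (⊙-refinesʳ {𝒜} {ℬ} A₀∈𝒜)) (G-≤ᵣ-L (𝒜 ⊙ ℬ))
  , λ f _ → G-⊙-≤L 𝒜 ℬ f
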